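{- Let $q$ be a prime power and let $j,k,m$ be integers with $0\leq m\leq j-1$ and $2\leq j\leq k$. Then \[ \varphi^{+}_{1,j-m}(q)\begin{bmatrix}j\\ m\end{bmatrix}_{q}^{ - }q^{\binom{m}{2}-mk}\geq\varphi^{+}_{1,j-m-1}(q)\begin{bmatrix}j\\ m+1\end{bmatrix}_{q}^{ - }q^{\binom{m+1}{2}-(m+1)k}. \]
   Context: For $b\ge a\ge 0$: $\varphi^{+}_{a,b}(q)=\prod_{k=a}^{b}(q^k+(-1)^k)$, $\varphi^{ - }_{a,b}(q)=\prod_{k=a}^{b}(q^k-(-1)^k)$, with empty products $\varphi^{\pm}_{a,a-1}=1$; $\begin{bmatrix}b\\ a\end{bmatrix}_{q}^{ - }=\varphi^{ - }_{b-a+1,b}(q)/\varphi^{ - }_{1,a}(q)$, set to $0$ if $a<0$ or $b<a$. -}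

module Defs where

open import Data.Nat as ℕ using (ℕ; zero; suc; _≤_; _∸_)
open import Data.Nat.Primality using (Prime)
open import Data.Nat.Combinatorics using (_C_)
open import Data.Integer as ℤ using (ℤ; +_; -[1+_])
open import Data.Rational as ℚ using (ℚ; 0ℚ; 1ℚ; _+_; _-_; _*_; _÷_; -_; 1/_; ≢-nonZero)
open import Data.Rational.Properties using (_≟_)
open import Data.Product using (Σ; _×_)
open import Relation.Binary.PropositionalEquality using (_≡_)
open import Relation.Nullary using (yes; no)

IsPrimePower : ℕ → Set
IsPrimePower q = Σ ℕ λ p → Σ ℕ λ e → Prime p × (1 ≤ e) × (q ≡ p ℕ.^ e)

qℚ : ℕ → ℚ
qℚ n = (+ n) ℚ./ 1

_^ℕ_ : ℚ → ℕ → ℚ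
x ^ℕ zero = 1ℚ
x ^ℕ suc n = x * (x ^ℕ n)

sgn : ℕ → ℚ
sgn k = (- 1ℚ) ^ℕ k

-- integer powers in ℚ (x^(-n) = 1 / x^n; set to 0 if x^n = 0, never used here)
_^ℤ_ : ℚ → ℤ → ℚ
x ^ℤ (+ n) = x ^ℕ n
x ^ℤ -[1+ n ] with x ^ℕ suc n ≟ 0ℚ
... | yes _ = 0ℚ
... | no ne = 1/_ (x ^ℕ suc n) {{≢-nonZero ne}}

-- total division: p / r, with p / 0 := 0 (denominators here are never 0)
_÷?_ : ℚ → ℚ → ℚ
p ÷? r with r ≟ 0ℚ
... | yes _ = 0ℚ
... | no ne = _÷_ p r {{≢-nonZero ne}}

prodFrom : (ℕ → ℚ) → ℕ → ℕ → ℚ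
prodFrom f a zero = 1ℚ
prodFrom f a (suc len) = f a * prodFrom f (suc a) len

-- φ⁺_{a,b}(q) = ∏_{k=a}^{b} (q^k + (-1)^k), empty (=1) when b < a
φ⁺ : ℕ → ℕ → ℕ → ℚ
φ⁺ a b q = prodFrom (λ k → (qℚ q ^ℕ k) + sgn k) a (suc b ∸ a)

-- φ⁻_{a,b}(q) = ∏_{k=a}^{b} (q^k - (-1)^k), empty (=1) when b < a
φ⁻ : ℕ → ℕ → ℕ → ℚ
φ⁻ a b q = prodFrom (λ k → (qℚ q ^ℕ k) - sgn k) a (suc b ∸ a)

-- [b a]⁻_q = φ⁻_{b-a+1,b}(q) / φ⁻_{1,a}(q), and 0 if b < a
gauss⁻ : ℕ → ℕ → ℕ → ℚ
gauss⁻ b a q with a ℕ.≤? b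
... | yes _ = φ⁻ (suc (b ∸ a)) b q ÷? φ⁻ 1 a q
... | no _ = 0ℚ

{-# OPTIONS --safe #-}
-- Put u = j - m. Multiplying both sides by the positive number (q^(m+1) - (-1)^(m+1)) q^k and using
--   [j, m+1]⁻ (q^(m+1) - (-1)^(m+1)) = (q^u - (-1)^u) [j, m]⁻,
--   q^(C(m+1,2) - (m+1)k) q^k = q^(C(m,2) - mk) q^m   and   φ⁺_{1,u} = φ⁺_{1,u-1} (q^u + (-1)^u)
-- reduces the claim to  (q^u - (-1)^u) q^m ≤ (q^u + (-1)^u) (q^(m+1) - (-1)^(m+1)) q^k.
-- Since j ≥ 2, either u ≥ 2 or m ≥ 1, so for q ≥ 2 the product of the two factors on the right is
-- at least 2; with q^k ≥ q^(u+m) the right side is at least 2 q^u q^m ≥ (q^u + 1) q^m.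
module Submission where

open import Defs
open import Data.Nat using (ℕ; _≤_; _∸_; suc) renaming (_*_ to _*ℕ_)
open import Data.Nat.Combinatorics using (_C_; nCk+nC[k+1]≡[n+1]C[k+1]; nC1≡n)
open import Data.Integer using (+_; _-_)
open import Data.Rational using (ℚ; _*_) renaming (_≤_ to _≤ℚ_)

open import Data.Nat as ℕ using (zero; z≤n; s≤s)
import Data.Nat.Properties as ℕ
import Data.Nat.Coprimality as Coprime
open import Data.Integer as ℤ using (-[1+_]; _⊖_)
import Data.Integer.Properties as ℤ
open import Data.Rational as ℚ
  using (0ℚ; 1ℚ; _+_; -_; 1/_; mkℚ; *≤*; positive; nonNegative) renaming (_<_ to _<ℚ_)
open import Data.Rational.Properties
import Algebra.Properties.CommutativeSemigroup as CommSemigroupProperties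
open import Algebra.Bundles using (CommutativeMonoid)
open import Data.Sum using (_⊎_; inj₁; inj₂)
open import Data.Product using (_,_)
open import Relation.Binary.PropositionalEquality
  using (_≡_; _≢_; refl; sym; trans; cong; cong₂; subst; subst₂; module ≡-Reasoning)
open import Relation.Nullary using (yes; no; contradiction)
open import Data.Nat.Primality using (prime⇒nonTrivial; prime⇒nonZero)
open import Data.Rational.Solver using (module +-*-Solver)

*-pos : ∀ {p r} → 0ℚ <ℚ p → 0ℚ <ℚ r → 0ℚ <ℚ p * r
*-pos {p} {r} 0<p 0<r = positive⁻¹ _ {{pos*pos⇒pos p {{positive 0<p}} r {{positive 0<r}}}}

*-nonNeg : ∀ {p r} → 0ℚ ≤ℚ p → 0ℚ ≤ℚ r → 0ℚ ≤ℚ p * r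
*-nonNeg {p} {r} 0≤p 0≤r = nonNegative⁻¹ _ {{nonNeg*nonNeg⇒nonNeg p {{nonNegative 0≤p}} r {{nonNegative 0≤r}}}}

pos⇒≢0 : ∀ {p} → 0ℚ <ℚ p → p ≢ 0ℚ
pos⇒≢0 0<p p≡0 = <-irrefl (sym p≡0) 0<p

*-mono-≤-nonNeg : ∀ {a b c d} → 0ℚ ≤ℚ a → a ≤ℚ b → 0ℚ ≤ℚ c → c ≤ℚ d → a * c ≤ℚ b * d
*-mono-≤-nonNeg {a} {b} {c} {d} 0≤a a≤b 0≤c c≤d = begin
  a * c ≤⟨ *-monoʳ-≤-nonNeg c {{nonNegative 0≤c}} a≤b ⟩
  b * c ≤⟨ *-monoˡ-≤-nonNeg b {{nonNegative (≤-trans 0≤a a≤b)}} c≤d ⟩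
  b * d ∎
  where open ≤-Reasoning

qℚ-mono-≤ : ∀ {m n} → m ≤ n → qℚ m ≤ℚ qℚ n
qℚ-mono-≤ {m} {n} m≤n = subst₂ _≤ℚ_ (sym (qℚ≡mkℚ m)) (sym (qℚ≡mkℚ n))
  (*≤* (subst₂ ℤ._≤_ (sym (ℤ.*-identityʳ (+ m))) (sym (ℤ.*-identityʳ (+ n))) (ℤ.+≤+ m≤n)))
  where
  qℚ≡mkℚ : ∀ n → qℚ n ≡ mkℚ (+ n) 0 (Coprime.sym (Coprime.1-coprimeTo n))
  qℚ≡mkℚ n = normalize-coprime (Coprime.sym (Coprime.1-coprimeTo n))

p÷?r*r≡p : ∀ p {r} → r ≢ 0ℚ → (p ÷? r) * r ≡ p
p÷?r*r≡p p {r} r≢0 with r ≟ 0ℚ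
... | yes r≡0 = contradiction r≡0 r≢0
... | no r≢0 = begin
  p * 1/ r * r    ≡⟨ *-assoc p (1/ r) r ⟩
  p * (1/ r * r)  ≡⟨ cong (p *_) (*-inverseˡ r) ⟩
  p * 1ℚ          ≡⟨ *-identityʳ p ⟩
  p               ∎
  where open ≡-Reasoning; instance _ = ℚ.≢-nonZero r≢0

p*r÷?r≡p : ∀ p {r} → r ≢ 0ℚ → (p * r) ÷? r ≡ p
p*r÷?r≡p p {r} r≢0 with r ≟ 0ℚ
... | yes r≡0 = contradiction r≡0 r≢0
... | no r≢0 = begin
  p * r * 1/ r    ≡⟨ *-assoc p r (1/ r) ⟩
  p * (r * 1/ r)  ≡⟨ cong (p *_) (*-inverseʳ r) ⟩
  p * 1ℚ          ≡⟨ *-identityʳ p ⟩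
  p               ∎
  where open ≡-Reasoning; instance _ = ℚ.≢-nonZero r≢0

*-cancelʳ-≡ : ∀ {p s r} → r ≢ 0ℚ → p * r ≡ s * r → p ≡ s
*-cancelʳ-≡ {p} {s} {r} r≢0 pr≡sr = begin
  p              ≡⟨ sym (p*r÷?r≡p p r≢0) ⟩
  (p * r) ÷? r   ≡⟨ cong (_÷? r) pr≡sr ⟩
  (s * r) ÷? r   ≡⟨ p*r÷?r≡p s r≢0 ⟩
  s              ∎
  where open ≡-Reasoning

÷?-pos : ∀ {p r} → 0ℚ <ℚ p → 0ℚ <ℚ r → 0ℚ <ℚ p ÷? r
÷?-pos {p} {r} 0<p 0<r with r ≟ 0ℚ
... | yes r≡0 = contradiction r≡0 (pos⇒≢0 0<r)
... | no r≢0 = *-pos 0<p (positive⁻¹ _ {{1/pos⇒pos r {{positive 0<r}}}})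

^ℕ-+ : ∀ x a b → x ^ℕ (a ℕ.+ b) ≡ x ^ℕ a * x ^ℕ b
^ℕ-+ x zero b = sym (*-identityˡ (x ^ℕ b))
^ℕ-+ x (suc a) b = trans (cong (x *_) (^ℕ-+ x a b)) (sym (*-assoc x (x ^ℕ a) (x ^ℕ b)))

^ℕ-pos : ∀ {x} → 0ℚ <ℚ x → ∀ n → 0ℚ <ℚ x ^ℕ n
^ℕ-pos 0<x zero = positive⁻¹ 1ℚ
^ℕ-pos 0<x (suc n) = *-pos 0<x (^ℕ-pos 0<x n)

module _ {x : ℚ} (1≤x : 1ℚ ≤ℚ x) where

  private
    0≤x : 0ℚ ≤ℚ x
    0≤x = ≤-trans (nonNegative⁻¹ 1ℚ) 1≤x

  1≤^ℕ : ∀ n → 1ℚ ≤ℚ x ^ℕ n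
  1≤^ℕ zero = ≤-refl
  1≤^ℕ (suc n) = *-mono-≤-nonNeg (nonNegative⁻¹ 1ℚ) 1≤x (nonNegative⁻¹ 1ℚ) (1≤^ℕ n)

  ^ℕ-monoʳ-≤ : ∀ {a b} → a ≤ b → x ^ℕ a ≤ℚ x ^ℕ b
  ^ℕ-monoʳ-≤ {b = b} z≤n = 1≤^ℕ b
  ^ℕ-monoʳ-≤ (s≤s a≤b) = *-monoˡ-≤-nonNeg x {{nonNegative 0≤x}} (^ℕ-monoʳ-≤ a≤b)

  x≤x^ℕ[1+n] : ∀ n → x ≤ℚ x ^ℕ suc n
  x≤x^ℕ[1+n] n = subst (_≤ℚ x ^ℕ suc n) (*-identityʳ x) (^ℕ-monoʳ-≤ {1} {suc n} (s≤s z≤n))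

^ℤ-pos : ∀ {x} → 0ℚ <ℚ x → ∀ z → 0ℚ <ℚ x ^ℤ z
^ℤ-pos 0<x (+ n) = ^ℕ-pos 0<x n
^ℤ-pos {x} 0<x -[1+ n ] with x ^ℕ suc n ≟ 0ℚ
... | yes xⁿ≡0 = contradiction xⁿ≡0 (pos⇒≢0 (^ℕ-pos 0<x (suc n)))
... | no _ = positive⁻¹ _ {{1/pos⇒pos (x ^ℕ suc n) {{positive (^ℕ-pos 0<x (suc n))}}}}

x^[a⊖b]*x^b≡x^a : ∀ {x} → 0ℚ <ℚ x → ∀ a b → (x ^ℤ (a ⊖ b)) * x ^ℕ b ≡ x ^ℕ a
x^[a⊖b]*x^b≡x^a {x} 0<x a zero = *-identityʳ (x ^ℕ a)
x^[a⊖b]*x^b≡x^a {x} 0<x zero (suc b) with x ^ℕ suc b ≟ 0ℚ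
... | yes xᵇ≡0 = contradiction xᵇ≡0 (pos⇒≢0 (^ℕ-pos 0<x (suc b)))
... | no xᵇ≢0 = *-inverseˡ (x ^ℕ suc b) {{ℚ.≢-nonZero xᵇ≢0}}
x^[a⊖b]*x^b≡x^a {x} 0<x (suc a) (suc b) = begin
  x ^ℤ (suc a ⊖ suc b) * (x * x ^ℕ b)  ≡⟨ cong (λ z → x ^ℤ z * (x * x ^ℕ b)) (ℤ.[1+m]⊖[1+n]≡m⊖n a b) ⟩
  x ^ℤ (a ⊖ b) * (x * x ^ℕ b)          ≡⟨ x∙yz≈y∙xz (x ^ℤ (a ⊖ b)) x (x ^ℕ b) ⟩
  x * (x ^ℤ (a ⊖ b) * x ^ℕ b)          ≡⟨ cong (x *_) (x^[a⊖b]*x^b≡x^a 0<x a b) ⟩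
  x * x ^ℕ a                            ∎
  where
  open ≡-Reasoning
  open CommSemigroupProperties (CommutativeMonoid.commutativeSemigroup *-1-commutativeMonoid)

x^[a-b]*x^b≡x^a : ∀ {x} → 0ℚ <ℚ x → ∀ a b → (x ^ℤ (+ a - + b)) * x ^ℕ b ≡ x ^ℕ a
x^[a-b]*x^b≡x^a {x} 0<x a b =
  trans (cong (λ z → x ^ℤ z * x ^ℕ b) (ℤ.m-n≡m⊖n a b)) (x^[a⊖b]*x^b≡x^a 0<x a b)

^ℤ-shift : ∀ {x} → 0ℚ <ℚ x → ∀ a b c d →
  (x ^ℤ (+ (c ℕ.+ a) - + (d ℕ.+ b))) * x ^ℕ d ≡ (x ^ℤ (+ a - + b)) * x ^ℕ c
^ℤ-shift {x} 0<x a b c d = *-cancelʳ-≡ (pos⇒≢0 (^ℕ-pos 0<x b)) (begin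
  E′ * x ^ℕ d * x ^ℕ b      ≡⟨ *-assoc E′ (x ^ℕ d) (x ^ℕ b) ⟩
  E′ * (x ^ℕ d * x ^ℕ b)    ≡⟨ cong (E′ *_) (sym (^ℕ-+ x d b)) ⟩
  E′ * x ^ℕ (d ℕ.+ b)       ≡⟨ x^[a-b]*x^b≡x^a 0<x (c ℕ.+ a) (d ℕ.+ b) ⟩
  x ^ℕ (c ℕ.+ a)            ≡⟨ ^ℕ-+ x c a ⟩
  x ^ℕ c * x ^ℕ a           ≡⟨ cong (x ^ℕ c *_) (sym (x^[a-b]*x^b≡x^a 0<x a b)) ⟩
  x ^ℕ c * (E * x ^ℕ b)     ≡⟨ sym (*-assoc (x ^ℕ c) E (x ^ℕ b)) ⟩
  x ^ℕ c * E * x ^ℕ b       ≡⟨ cong (_* x ^ℕ b) (*-comm (x ^ℕ c) E) ⟩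
  E * x ^ℕ c * x ^ℕ b       ∎)
  where
  open ≡-Reasoning
  E′ = x ^ℤ (+ (c ℕ.+ a) - + (d ℕ.+ b))
  E = x ^ℤ (+ a - + b)

^ℤ-exponent-step : ∀ {x} → 0ℚ <ℚ x → ∀ m k →
  (x ^ℤ (+ (suc m C 2) - + (suc m *ℕ k))) * x ^ℕ k ≡ (x ^ℤ (+ (m C 2) - + (m *ℕ k))) * x ^ℕ m
^ℤ-exponent-step {x} 0<x m k =
  trans (cong (λ e → x ^ℤ (+ e - + (suc m *ℕ k)) * x ^ℕ k) [1+m]C2≡m+mC2) (^ℤ-shift 0<x (m C 2) (m *ℕ k) m k)
  where
  [1+m]C2≡m+mC2 : suc m C 2 ≡ m ℕ.+ m C 2
  [1+m]C2≡m+mC2 = trans (sym (nCk+nC[k+1]≡[n+1]C[k+1] m 1)) (cong (ℕ._+ m C 2) (nC1≡n m))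

sgn≡±1 : ∀ k → sgn k ≡ 1ℚ ⊎ sgn k ≡ - 1ℚ
sgn≡±1 zero = inj₁ refl
sgn≡±1 (suc k) with sgn≡±1 k
... | inj₁ s≡1 rewrite s≡1 = inj₂ refl
... | inj₂ s≡-1 rewrite s≡-1 = inj₁ refl

-1≤1 : - 1ℚ ≤ℚ 1ℚ
-1≤1 = *≤* ℤ.-≤+

-1≤sgn : ∀ k → - 1ℚ ≤ℚ sgn k
-1≤sgn k with sgn≡±1 k
... | inj₁ s≡1 rewrite s≡1 = -1≤1
... | inj₂ s≡-1 rewrite s≡-1 = ≤-refl

-1≤-sgn : ∀ k → - 1ℚ ≤ℚ - sgn k
-1≤-sgn k with sgn≡±1 k
... | inj₁ s≡1 rewrite s≡1 = ≤-refl
... | inj₂ s≡-1 rewrite s≡-1 = -1≤1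

-sgn≤1 : ∀ k → - sgn k ≤ℚ 1ℚ
-sgn≤1 k = neg-antimono-≤ (-1≤sgn k)

-- The factors of φ⁺ and φ⁻: φ⁺ 1 n q is definitionally prodFrom (f⁺ q) 1 n, and likewise for φ⁻.
f⁺ f⁻ : ℕ → ℕ → ℚ
f⁺ q k = qℚ q ^ℕ k + sgn k
f⁻ q k = qℚ q ^ℕ k ℚ.- sgn k

q^k-1≤f⁺ : ∀ q k → qℚ q ^ℕ k ℚ.- 1ℚ ≤ℚ f⁺ q k
q^k-1≤f⁺ q k = +-monoʳ-≤ (qℚ q ^ℕ k) (-1≤sgn k)

q^k-1≤f⁻ : ∀ q k → qℚ q ^ℕ k ℚ.- 1ℚ ≤ℚ f⁻ q k
q^k-1≤f⁻ q k = +-monoʳ-≤ (qℚ q ^ℕ k) (-1≤-sgn k)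

f⁻≤q^k+1 : ∀ q k → f⁻ q k ≤ℚ qℚ q ^ℕ k + 1ℚ
f⁻≤q^k+1 q k = +-monoʳ-≤ (qℚ q ^ℕ k) (-sgn≤1 k)

prodFrom-snoc : ∀ f a n → prodFrom f a (suc n) ≡ prodFrom f a n * f (a ℕ.+ n)
prodFrom-snoc f a zero =
  trans (*-identityʳ (f a)) (trans (cong f (sym (ℕ.+-identityʳ a))) (sym (*-identityˡ _)))
prodFrom-snoc f a (suc n) = begin
  f a * prodFrom f (suc a) (suc n)                  ≡⟨ cong (f a *_) (prodFrom-snoc f (suc a) n) ⟩
  f a * (prodFrom f (suc a) n * f (suc a ℕ.+ n))    ≡⟨ sym (*-assoc (f a) _ _) ⟩
  f a * prodFrom f (suc a) n * f (suc a ℕ.+ n)      ≡⟨ cong (λ i → f a * prodFrom f (suc a) n * f i) (sym (ℕ.+-suc a n)) ⟩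
  f a * prodFrom f (suc a) n * f (a ℕ.+ suc n)      ∎
  where open ≡-Reasoning

prodFrom-pos : ∀ f a n → (∀ {i} → a ≤ i → 0ℚ <ℚ f i) → 0ℚ <ℚ prodFrom f a n
prodFrom-pos f a zero _ = positive⁻¹ 1ℚ
prodFrom-pos f a (suc n) f-pos =
  *-pos (f-pos ℕ.≤-refl) (prodFrom-pos f (suc a) n (λ a<i → f-pos (ℕ.<⇒≤ a<i)))

φ⁺-snoc : ∀ q {u} → 1 ≤ u → φ⁺ 1 u q ≡ φ⁺ 1 (u ∸ 1) q * f⁺ q u
φ⁺-snoc q {suc u} _ = prodFrom-snoc (f⁺ q) 1 u

gauss⁻-+ : ∀ q m n → gauss⁻ (m ℕ.+ n) m q ≡ prodFrom (f⁻ q) (suc n) m ÷? prodFrom (f⁻ q) 1 m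
gauss⁻-+ q m n with m ℕ.≤? m ℕ.+ n
... | no m≰m+n = contradiction (ℕ.m≤m+n m n) m≰m+n
... | yes _ rewrite ℕ.m+n∸m≡n m n | ℕ.m+n∸n≡m m n = refl

module _ {q : ℕ} (2≤q : 2 ≤ q) where

  2≤qℚ : qℚ 2 ≤ℚ qℚ q
  2≤qℚ = qℚ-mono-≤ 2≤q

  1≤qℚ : 1ℚ ≤ℚ qℚ q
  1≤qℚ = qℚ-mono-≤ (ℕ.≤-trans (s≤s z≤n) 2≤q)

  0<qℚ : 0ℚ <ℚ qℚ q
  0<qℚ = <-≤-trans (positive⁻¹ 1ℚ) 1≤qℚ

  2≤q^[1+i] : ∀ i → qℚ 2 ≤ℚ qℚ q ^ℕ suc i
  2≤q^[1+i] i = ≤-trans 2≤qℚ (x≤x^ℕ[1+n] 1≤qℚ i)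

  4≤q^[2+i] : ∀ i → qℚ 4 ≤ℚ qℚ q ^ℕ suc (suc i)
  4≤q^[2+i] i = *-mono-≤-nonNeg (nonNegative⁻¹ (qℚ 2)) 2≤qℚ (nonNegative⁻¹ (qℚ 2)) (2≤q^[1+i] i)

  1≤q^[1+i]-1 : ∀ i → 1ℚ ≤ℚ qℚ q ^ℕ suc i ℚ.- 1ℚ
  1≤q^[1+i]-1 i = +-monoˡ-≤ (- 1ℚ) (2≤q^[1+i] i)

  2≤q^[2+i]-1 : ∀ i → qℚ 2 ≤ℚ qℚ q ^ℕ suc (suc i) ℚ.- 1ℚ
  2≤q^[2+i]-1 i = +-monoˡ-≤ (- 1ℚ) (≤-trans (qℚ-mono-≤ (ℕ.n≤1+n 3)) (4≤q^[2+i] i))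

  1≤f⁺ : ∀ i → 1ℚ ≤ℚ f⁺ q (suc i)
  1≤f⁺ i = ≤-trans (1≤q^[1+i]-1 i) (q^k-1≤f⁺ q (suc i))

  1≤f⁻ : ∀ i → 1ℚ ≤ℚ f⁻ q (suc i)
  1≤f⁻ i = ≤-trans (1≤q^[1+i]-1 i) (q^k-1≤f⁻ q (suc i))

  2≤f⁺ : ∀ i → qℚ 2 ≤ℚ f⁺ q (suc (suc i))
  2≤f⁺ i = ≤-trans (2≤q^[2+i]-1 i) (q^k-1≤f⁺ q (suc (suc i)))

  2≤f⁻ : ∀ i → qℚ 2 ≤ℚ f⁻ q (suc (suc i))
  2≤f⁻ i = ≤-trans (2≤q^[2+i]-1 i) (q^k-1≤f⁻ q (suc (suc i)))

  f⁺-pos : ∀ {i} → 1 ≤ i → 0ℚ <ℚ f⁺ q i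
  f⁺-pos {suc i} _ = <-≤-trans (positive⁻¹ 1ℚ) (1≤f⁺ i)

  f⁻-pos : ∀ {i} → 1 ≤ i → 0ℚ <ℚ f⁻ q i
  f⁻-pos {suc i} _ = <-≤-trans (positive⁻¹ 1ℚ) (1≤f⁻ i)

  φ⁺-pos : ∀ n → 0ℚ <ℚ φ⁺ 1 n q
  φ⁺-pos n = prodFrom-pos (f⁺ q) 1 n f⁺-pos

  φ⁻-pos : ∀ a b → 0ℚ <ℚ φ⁻ (suc a) b q
  φ⁻-pos a b = prodFrom-pos (f⁻ q) (suc a) (b ∸ a) (λ a<i → f⁻-pos (ℕ.≤-trans (s≤s z≤n) a<i))

  gauss⁻-nonNeg : ∀ b a → 0ℚ ≤ℚ gauss⁻ b a q
  gauss⁻-nonNeg b a with a ℕ.≤? b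
  ... | no _ = ≤-refl
  ... | yes _ = <⇒≤ (÷?-pos (φ⁻-pos (b ∸ a) b) (φ⁻-pos 0 a))

  gauss⁻-recurrence : ∀ {j m} → m ℕ.< j → gauss⁻ j (suc m) q * f⁻ q (suc m) ≡ f⁻ q (j ∸ m) * gauss⁻ j m q
  gauss⁻-recurrence {j} {m} m<j with n , sm+n≡j ← ℕ.m≤n⇒∃[o]m+o≡n m<j
    with refl ← trans (ℕ.+-suc m n) sm+n≡j =
    -- [j, m+1]⁻ = a P / (D b) and [j, m]⁻ = P / D share the factors P and D.
    *-cancelʳ-≡ (pos⇒≢0 D-pos) (begin
      G₁ * b * D                   ≡⟨ *-assoc G₁ b D ⟩
      G₁ * (b * D)                 ≡⟨ cong (G₁ *_) (*-comm b D) ⟩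
      G₁ * (D * b)                 ≡⟨ cong (_* (D * b)) G₁≡ ⟩
      (a * P) ÷? (D * b) * (D * b) ≡⟨ p÷?r*r≡p (a * P) (pos⇒≢0 (*-pos D-pos b-pos)) ⟩
      a * P                        ≡⟨ cong (a *_) (sym (p÷?r*r≡p P (pos⇒≢0 D-pos))) ⟩
      a * (P ÷? D * D)             ≡⟨ sym (*-assoc a (P ÷? D) D) ⟩
      a * (P ÷? D) * D             ≡⟨ cong₂ (λ i g → f⁻ q i * g * D) (sym (ℕ.m+n∸m≡n m (suc n))) (sym (gauss⁻-+ q m (suc n))) ⟩
      f⁻ q (j ∸ m) * G₀ * D        ∎)
    where
    open ≡-Reasoning
    G₁ = gauss⁻ j (suc m) q
    G₀ = gauss⁻ j m q
    a = f⁻ q (suc n)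
    b = f⁻ q (suc m)
    P = prodFrom (f⁻ q) (suc (suc n)) m
    D = prodFrom (f⁻ q) 1 m
    D-pos = φ⁻-pos 0 m
    b-pos = f⁻-pos {suc m} (s≤s z≤n)
    G₁≡ : G₁ ≡ (a * P) ÷? (D * b)
    G₁≡ = begin
      G₁                                    ≡⟨ cong (λ j → gauss⁻ j (suc m) q) (ℕ.+-suc m n) ⟩
      gauss⁻ (suc m ℕ.+ n) (suc m) q        ≡⟨ gauss⁻-+ q (suc m) n ⟩
      (a * P) ÷? prodFrom (f⁻ q) 1 (suc m)  ≡⟨ cong ((a * P) ÷?_) (prodFrom-snoc (f⁻ q) 1 m) ⟩
      (a * P) ÷? (D * b)                    ∎

  2≤f⁺*f⁻ : ∀ {u m} → 1 ≤ u → 2 ≤ u ℕ.+ m → qℚ 2 ≤ℚ f⁺ q u * f⁻ q (suc m)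
  2≤f⁺*f⁻ {suc zero} {zero} _ (s≤s ())
  2≤f⁺*f⁻ {suc zero} {suc m} _ _ =
    *-mono-≤-nonNeg (nonNegative⁻¹ 1ℚ) (1≤f⁺ 0) (nonNegative⁻¹ (qℚ 2)) (2≤f⁻ m)
  2≤f⁺*f⁻ {suc (suc u)} {m} _ _ =
    *-mono-≤-nonNeg (nonNegative⁻¹ (qℚ 2)) (2≤f⁺ u) (nonNegative⁻¹ 1ℚ) (1≤f⁻ m)

  f⁻*qᵐ≤f⁺*f⁻*qᵏ : ∀ {j m k} → m ℕ.< j → 2 ≤ j → j ≤ k →
    f⁻ q (j ∸ m) * qℚ q ^ℕ m ≤ℚ f⁺ q (j ∸ m) * f⁻ q (suc m) * qℚ q ^ℕ k
  f⁻*qᵐ≤f⁺*f⁻*qᵏ {j} {m} {k} m<j 2≤j j≤k = begin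
    f⁻ q u * y             ≤⟨ *-monoʳ-≤-nonNeg y {{y≥0}} (f⁻≤q^k+1 q u) ⟩
    (x + 1ℚ) * y           ≤⟨ *-monoʳ-≤-nonNeg y {{y≥0}} (+-monoʳ-≤ x (1≤^ℕ 1≤qℚ u)) ⟩
    (x + x) * y            ≡⟨ cong (_* y) x+x≡2*x ⟩
    qℚ 2 * x * y           ≡⟨ *-assoc (qℚ 2) x y ⟩
    qℚ 2 * (x * y)         ≤⟨ *-monoʳ-≤-nonNeg (x * y) {{xy≥0}} 2≤c ⟩
    c * (x * y)            ≡⟨ cong (c *_) (sym (^ℕ-+ (qℚ q) u m)) ⟩
    c * qℚ q ^ℕ (u ℕ.+ m)  ≡⟨ cong (λ i → c * qℚ q ^ℕ i) u+m≡j ⟩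
    c * qℚ q ^ℕ j          ≤⟨ *-monoˡ-≤-nonNeg c {{c≥0}} (^ℕ-monoʳ-≤ 1≤qℚ j≤k) ⟩
    c * qℚ q ^ℕ k          ∎
    where
    open ≤-Reasoning
    u = j ∸ m
    u+m≡j : u ℕ.+ m ≡ j
    u+m≡j = ℕ.m∸n+n≡m (ℕ.<⇒≤ m<j)
    x = qℚ q ^ℕ u
    y = qℚ q ^ℕ m
    c = f⁺ q u * f⁻ q (suc m)
    2≤c : qℚ 2 ≤ℚ c
    2≤c = 2≤f⁺*f⁻ (ℕ.m<n⇒0<n∸m m<j) (subst (2 ≤_) (sym u+m≡j) 2≤j)
    y≥0 = nonNegative (<⇒≤ (^ℕ-pos 0<qℚ m))
    xy≥0 = nonNegative (<⇒≤ (*-pos (^ℕ-pos 0<qℚ u) (^ℕ-pos 0<qℚ m)))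
    c≥0 = nonNegative (≤-trans (nonNegative⁻¹ (qℚ 2)) 2≤c)
    x+x≡2*x : x + x ≡ qℚ 2 * x
    x+x≡2*x = sym (trans (*-distribʳ-+ x 1ℚ 1ℚ) (cong₂ _+_ (*-identityˡ x) (*-identityˡ x)))

IsPrimePower⇒2≤ : ∀ {q} → IsPrimePower q → 2 ≤ q
IsPrimePower⇒2≤ (p , suc e , p-prime , _ , refl) =
  ℕ.*-mono-≤ (ℕ.nonTrivial⇒n>1 p {{prime⇒nonTrivial p-prime}}) (ℕ.m^n>0 p {{prime⇒nonZero p-prime}} e)

lemma3p11 : (q j k m : ℕ) → IsPrimePower q → m ≤ j ∸ 1 → 2 ≤ j → j ≤ k →
    φ⁺ 1 (j ∸ m ∸ 1) q * gauss⁻ j (suc m) q * (qℚ q ^ℤ ((+ (suc m C 2)) - (+ (suc m *ℕ k))))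
      ≤ℚ φ⁺ 1 (j ∸ m) q * gauss⁻ j m q * (qℚ q ^ℤ ((+ (m C 2)) - (+ (m *ℕ k))))
lemma3p11 q j k m q-pp m≤j∸1 2≤j j≤k = *-cancelʳ-≤-pos (b * K) {{positive bK>0}} (begin
  A * G₁ * E₁ * (b * K)      ≡⟨ solve 5 (λ A G E b K → A :* G :* E :* (b :* K) := A :* (G :* b) :* (E :* K)) refl A G₁ E₁ b K ⟩
  A * (G₁ * b) * (E₁ * K)    ≡⟨ cong₂ (λ g e → A * g * e) (gauss⁻-recurrence 2≤q m<j) (^ℤ-exponent-step (0<qℚ 2≤q) m k) ⟩
  A * (a * G₀) * (E₀ * Qᵐ)   ≡⟨ solve 5 (λ A a G E Q → A :* (a :* G) :* (E :* Q) := A :* G :* E :* (a :* Q)) refl A a G₀ E₀ Qᵐ ⟩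
  A * G₀ * E₀ * (a * Qᵐ)     ≤⟨ *-monoˡ-≤-nonNeg (A * G₀ * E₀) {{nonNegative AG₀E₀≥0}} (f⁻*qᵐ≤f⁺*f⁻*qᵏ 2≤q m<j 2≤j j≤k) ⟩
  A * G₀ * E₀ * (c * b * K)  ≡⟨ solve 6 (λ A G E c b K → A :* G :* E :* (c :* b :* K) := A :* c :* G :* E :* (b :* K)) refl A G₀ E₀ c b K ⟩
  A * c * G₀ * E₀ * (b * K)  ≡⟨ cong (λ φ → φ * G₀ * E₀ * (b * K)) (sym (φ⁺-snoc q (ℕ.m<n⇒0<n∸m m<j))) ⟩
  φ⁺ 1 (j ∸ m) q * G₀ * E₀ * (b * K) ∎)
  where
  open ≤-Reasoning
  open +-*-Solver using (solve; _:*_; _:=_)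
  2≤q = IsPrimePower⇒2≤ q-pp
  m<j : m ℕ.< j
  m<j = ℕ.m≤pred[n]⇒suc[m]≤n {{ℕ.>-nonZero (ℕ.<⇒≤ 2≤j)}} m≤j∸1
  A = φ⁺ 1 (j ∸ m ∸ 1) q
  G₁ = gauss⁻ j (suc m) q
  G₀ = gauss⁻ j m q
  E₁ = qℚ q ^ℤ (+ (suc m C 2) - + (suc m *ℕ k))
  E₀ = qℚ q ^ℤ (+ (m C 2) - + (m *ℕ k))
  a = f⁻ q (j ∸ m)
  b = f⁻ q (suc m)
  c = f⁺ q (j ∸ m)
  K = qℚ q ^ℕ k
  Qᵐ = qℚ q ^ℕ m
  bK>0 = *-pos (f⁻-pos 2≤q {suc m} (s≤s z≤n)) (^ℕ-pos (0<qℚ 2≤q) k)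
  AG₀E₀≥0 = *-nonNeg (*-nonNeg (<⇒≤ (φ⁺-pos 2≤q (j ∸ m ∸ 1))) (gauss⁻-nonNeg 2≤q j m))
                     (<⇒≤ (^ℤ-pos (0<qℚ 2≤q) (+ (m C 2) - + (m *ℕ k))))
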